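{- The relation $\le_P$ of being polynomially related is a partial order on the set of numerical semigroups.
   Context: A numerical semigroup $S$ is a submonoid of $(\mathbb N,+)$ with finite complement; $\mathrm H_S(x)=\sum_{s\in S}x^s$ is its Hilbert series. For numerical semigroups $S,T$, write $S\le_P T$ ($S$ and $T$ are polynomially related) if there exist $f\in\mathbb Z[x]$ and an integer $w\ge1$ with $\mathrm H_S(x^w)f(x)=\mathrm H_T(x)$. -}

module Defs where

open import Data.Nat using (ℕ; zero; suc; _+_; _≤_; _%_; _/_; _≡ᵇ_)
open import Data.Integer using (ℤ; +_) renaming (_+_ to _+ℤ_; _*_ to _*ℤ_)
open import Data.Bool using (Bool; true; false; if_then_else_)
open import Data.List using (List; []; _∷_)
open import Data.Product using (Σ; ∃; _×_)
open import Relation.Binary.PropositionalEquality using (_≡_)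

record NumericalSemigroup : Set where
  field
    mem      : ℕ → Bool
    zero∈    : mem 0 ≡ true
    closed   : ∀ a b → mem a ≡ true → mem b ≡ true → mem (a + b) ≡ true
    cofinite : ∃ λ N → ∀ n → N ≤ n → mem n ≡ true
open NumericalSemigroup public

Series : Set
Series = ℕ → ℤ

-- Hilbert series H_S(x) = Σ_{s ∈ S} x^s.
H : NumericalSemigroup → Series
H S n = if mem S n then + 1 else + 0

-- Substitution x ↦ x^w : coefficient n of A(x^w) is A_{n/w} if w ∣ n, else 0.
-- (Only used with w ≥ 1; the w = 0 clause is an arbitrary filler.)
expand : ℕ → Series → Series
expand zero    a n = + 0
expand (suc k) a n = if (n % suc k) ≡ᵇ 0 then a (n / suc k) else + 0

shift : Series → Series
shift b zero    = + 0
shift b (suc n) = b n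

-- Polynomials in ℤ[x] as coefficient lists [c₀, c₁, …];
-- (c₀ + x g(x)) · A(x) = c₀ A(x) + x (g(x) A(x)).
mulPoly : List ℤ → Series → Series
mulPoly []      a n = + 0
mulPoly (c ∷ f) a n = (c *ℤ a n) +ℤ shift (mulPoly f a) n

_≤P_ : NumericalSemigroup → NumericalSemigroup → Set
S ≤P T = Σ (List ℤ) λ f → Σ ℕ λ w →
  (1 ≤ w) × (∀ n → mulPoly f (expand w (H S)) n ≡ H T n)

_≈S_ : NumericalSemigroup → NumericalSemigroup → Set
S ≈S T = ∀ n → mem S n ≡ mem T n

{-# OPTIONS --safe #-}
-- Reflexivity and transitivity are formal: H_T(x) = f(x) H_S(x^w) and H_U(x) = g(x) H_T(x^v)
-- give H_U(x) = g(x) f(x^v) H_S(x^(vw)). For antisymmetry let F be the Frobenius number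
-- of S and d the degree of f. Comparing coefficients of H_T at d + F w and far beyond it
-- shows that d + F w is a gap of T, so F(T) ≥ d + F w; symmetrically F ≥ e + F(T) v.
-- As F > 0 this forces w = v = 1 and d = 0, so f is a constant, which must be 1.
module Submission where

open import Defs
open import Algebra.Bundles using (AbelianGroup)
open import Data.Bool using (true; false)
open import Data.Empty using (⊥-elim)
open import Data.Integer using (ℤ; +_) renaming (_+_ to _+ᶻ_; _*_ to _*ᶻ_)
import Data.Integer.Properties as ℤ
open import Data.Integer.Tactic.RingSolver using (solve-∀)
import Data.Nat.Tactic.RingSolver as NatSolver
open import Data.List using (List; []; _∷_; _++_; replicate; map)
open import Data.Nat using (ℕ; zero; suc; _+_; _*_; _≤_; _<_; z≤n; s≤s; _%_; _≡ᵇ_; _<?_)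
open import Data.Nat.Divisibility
  using (_∣_; divides; _∣?_; ∣⇒≤; n∣m*n; ∣m+n∣m⇒∣n; *-monoˡ-∣; m%n≡0⇒n∣m)
open import Data.Nat.DivMod using (m*n%n≡0; m*n/n≡m)
import Data.Nat.Properties as ℕ
open import Data.Product using (∃; _×_; _,_; proj₁; proj₂)
open import Data.Sum using (_⊎_; inj₁; inj₂)
open import Function using (case_of_)
open import Relation.Binary.PropositionalEquality
open import Relation.Binary.Structures using (IsPartialOrder)
open import Relation.Nullary using (¬_; yes; no)

import Algebra.Properties.Group as GroupProperties
open GroupProperties (AbelianGroup.group ℤ.+-0-abelianGroup) using (∙-cancelˡ)

infixl 6 _+ˢ_

_+ˢ_ : Series → Series → Series
(a +ˢ b) n = a n +ᶻ b n

δ₀ : Series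
δ₀ zero    = + 1
δ₀ (suc n) = + 0

coef : List ℤ → ℕ → ℤ
coef []      k       = + 0
coef (c ∷ f) zero    = c
coef (c ∷ f) (suc k) = coef f k

shift-cong : ∀ {a b : Series} → a ≗ b → shift a ≗ shift b
shift-cong a≗b zero    = refl
shift-cong a≗b (suc n) = a≗b n

shift-+ˢ : ∀ (a b : Series) → shift (a +ˢ b) ≗ shift a +ˢ shift b
shift-+ˢ a b zero    = refl
shift-+ˢ a b (suc n) = refl

mulPoly-cong : ∀ f {a b : Series} → a ≗ b → mulPoly f a ≗ mulPoly f b
mulPoly-cong []      a≗b n = refl
mulPoly-cong (c ∷ f) a≗b n =
  cong₂ _+ᶻ_ (cong (c *ᶻ_) (a≗b n)) (shift-cong (mulPoly-cong f a≗b) n)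

expand-cong : ∀ k {a b : Series} → a ≗ b → expand (suc k) a ≗ expand (suc k) b
expand-cong k a≗b n with n % suc k ≡ᵇ 0
... | true  = a≗b _
... | false = refl

mulPoly-+ˢ : ∀ f (a b : Series) → mulPoly f (a +ˢ b) ≗ mulPoly f a +ˢ mulPoly f b
mulPoly-+ˢ []      a b n = refl
mulPoly-+ˢ (c ∷ f) a b n = begin
  c *ᶻ (a n +ᶻ b n) +ᶻ shift (mulPoly f (a +ˢ b)) n
    ≡⟨ cong (c *ᶻ (a n +ᶻ b n) +ᶻ_) (shift-cong (mulPoly-+ˢ f a b) n) ⟩
  c *ᶻ (a n +ᶻ b n) +ᶻ shift (mulPoly f a +ˢ mulPoly f b) n
    ≡⟨ cong (c *ᶻ (a n +ᶻ b n) +ᶻ_) (shift-+ˢ (mulPoly f a) (mulPoly f b) n) ⟩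
  c *ᶻ (a n +ᶻ b n) +ᶻ (shift (mulPoly f a) n +ᶻ shift (mulPoly f b) n)
    ≡⟨ distrib c (a n) (b n) _ _ ⟩
  (c *ᶻ a n +ᶻ shift (mulPoly f a) n) +ᶻ (c *ᶻ b n +ᶻ shift (mulPoly f b) n) ∎
  where
  open ≡-Reasoning
  distrib : ∀ c x y u v → c *ᶻ (x +ᶻ y) +ᶻ (u +ᶻ v) ≡ (c *ᶻ x +ᶻ u) +ᶻ (c *ᶻ y +ᶻ v)
  distrib = solve-∀

mulPoly-δ₀ : ∀ f → mulPoly f δ₀ ≗ coef f
mulPoly-δ₀ []      n       = refl
mulPoly-δ₀ (c ∷ f) zero    = trans (ℤ.+-identityʳ _) (ℤ.*-identityʳ c)
mulPoly-δ₀ (c ∷ f) (suc n) =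
  trans (cong₂ _+ᶻ_ (ℤ.*-zeroʳ c) (mulPoly-δ₀ f n)) (ℤ.+-identityˡ (coef f n))

shift-vanishing : ∀ {a : Series} → (∀ n → a n ≡ + 0) → ∀ n → shift a n ≡ + 0
shift-vanishing a≡0 zero    = refl
shift-vanishing a≡0 (suc n) = a≡0 n

mulPoly-vanishing : ∀ f (a : Series) → (∀ j → coef f j ≡ + 0) → ∀ n → mulPoly f a n ≡ + 0
mulPoly-vanishing []      a f≡0 n = refl
mulPoly-vanishing (c ∷ f) a f≡0 n =
  cong₂ _+ᶻ_ (cong (_*ᶻ a n) (f≡0 0)) (shift-vanishing (mulPoly-vanishing f a (λ j → f≡0 (suc j))) n)

mulPoly-window : ∀ f (a : Series) d → (∀ j → d < j → coef f j ≡ + 0) →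
  ∀ m → mulPoly f a (d + m) ≡ mulPoly f (λ i → a (i + m)) d
mulPoly-window []      a d       high≡0 m = refl
mulPoly-window (c ∷ f) a zero    high≡0 m =
  cong (c *ᶻ a m +ᶻ_)
    (shift-vanishing (mulPoly-vanishing f a (λ j → high≡0 (suc j) (s≤s z≤n))) m)
mulPoly-window (c ∷ f) a (suc d) high≡0 m =
  cong (c *ᶻ a (suc d + m) +ᶻ_) (mulPoly-window f a d (λ j d<j → high≡0 (suc j) (s≤s d<j)) m)

mulPoly-constant : ∀ f (a : Series) → (∀ j → 0 < j → coef f j ≡ + 0) →
  ∀ n → mulPoly f a n ≡ coef f 0 *ᶻ a n
mulPoly-constant f a high≡0 n = begin
  mulPoly f a n                        ≡⟨ mulPoly-window f a 0 high≡0 n ⟩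
  mulPoly f (λ i → a (i + n)) 0         ≡⟨ at-zero f ⟩
  coef f 0 *ᶻ a n                      ∎
  where
  open ≡-Reasoning
  at-zero : ∀ f → mulPoly f (λ i → a (i + n)) 0 ≡ coef f 0 *ᶻ a n
  at-zero []      = refl
  at-zero (c ∷ f) = ℤ.+-identityʳ _

expand-∣ : ∀ k (X : Series) q → expand (suc k) X (q * suc k) ≡ X q
expand-∣ k X q rewrite m*n%n≡0 q (suc k) ⦃ _ ⦄ | m*n/n≡m q (suc k) ⦃ _ ⦄ = refl

expand-∤ : ∀ k (X : Series) {n} → ¬ (suc k ∣ n) → expand (suc k) X n ≡ + 0
expand-∤ k X {n} ∤n with n % suc k in n%w≡r
... | zero  = ⊥-elim (∤n (m%n≡0⇒n∣m n (suc k) n%w≡r))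
... | suc _ = refl

expand-1 : ∀ (X : Series) → expand 1 X ≗ X
expand-1 X n = trans (cong (expand 1 X) (sym (ℕ.*-identityʳ n))) (expand-∣ 0 X n)

expand-offset : ∀ k (X : Series) q i →
  expand (suc k) X (i + q * suc k) ≡ expand (suc k) (λ j → X (j + q)) i
expand-offset k X q i with suc k ∣? i
... | yes (divides p refl) = begin
  expand (suc k) X (p * suc k + q * suc k) ≡⟨ cong (expand (suc k) X) (sym (ℕ.*-distribʳ-+ (suc k) p q)) ⟩
  expand (suc k) X ((p + q) * suc k)       ≡⟨ expand-∣ k X (p + q) ⟩
  X (p + q)                                ≡⟨ sym (expand-∣ k (λ j → X (j + q)) p) ⟩
  expand (suc k) (λ j → X (j + q)) (p * suc k) ∎
  where open ≡-Reasoning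
... | no ∤i = trans (expand-∤ k X ∤i+qw) (sym (expand-∤ k (λ j → X (j + q)) ∤i))
  where
  ∤i+qw : ¬ (suc k ∣ i + q * suc k)
  ∤i+qw ∣i+qw = ∤i (∣m+n∣m⇒∣n (subst (suc k ∣_) (ℕ.+-comm i (q * suc k)) ∣i+qw) (n∣m*n q))

expand-cong-suc : ∀ k {X Y : Series} → (∀ j → X (suc j) ≡ Y (suc j)) →
  ∀ i → expand (suc k) X (suc i) ≡ expand (suc k) Y (suc i)
expand-cong-suc k {X} {Y} X≡Y i with suc k ∣? suc i
... | yes (divides (suc q) eq) rewrite eq =
  trans (expand-∣ k X (suc q)) (trans (X≡Y q) (sym (expand-∣ k Y (suc q))))
... | no ∤i = trans (expand-∤ k X ∤i) (sym (expand-∤ k Y ∤i))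

expand-linear : ∀ k c (A B : Series) →
  expand (suc k) (λ m → c *ᶻ A m +ᶻ B m) ≗ λ n → c *ᶻ expand (suc k) A n +ᶻ expand (suc k) B n
expand-linear k c A B n with n % suc k ≡ᵇ 0
... | true  = refl
... | false = sym (trans (ℤ.+-identityʳ _) (ℤ.*-zeroʳ c))

expand-expand : ∀ a b (X : Series) → expand (suc b) (expand (suc a) X) ≗ expand (suc b * suc a) X
expand-expand a b X n with suc b * suc a ∣? n
... | yes (divides q refl) = begin
  expand (suc b) (expand (suc a) X) (q * (suc b * suc a))
    ≡⟨ cong (expand (suc b) (expand (suc a) X)) (reassoc q (suc b) (suc a)) ⟩
  expand (suc b) (expand (suc a) X) (q * suc a * suc b)
    ≡⟨ expand-∣ b (expand (suc a) X) (q * suc a) ⟩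
  expand (suc a) X (q * suc a)
    ≡⟨ expand-∣ a X q ⟩
  X q
    ≡⟨ sym (expand-∣ (a + b * suc a) X q) ⟩
  expand (suc b * suc a) X (q * (suc b * suc a)) ∎
  where
  open ≡-Reasoning
  reassoc : ∀ q u v → q * (u * v) ≡ q * v * u
  reassoc q u v = trans (cong (q *_) (ℕ.*-comm u v)) (sym (ℕ.*-assoc q v u))
... | no ∤n with suc b ∣? n
...   | no ∤b = trans (expand-∤ b (expand (suc a) X) ∤b) (sym (expand-∤ (a + b * suc a) X ∤n))
...   | yes (divides p refl) =
  trans (expand-∣ b (expand (suc a) X) p) (trans (expand-∤ a X ∤p) (sym (expand-∤ (a + b * suc a) X ∤n)))
  where
  ∤p : ¬ (suc a ∣ p)
  ∤p a∣p = ∤n (subst (_∣ p * suc b) (ℕ.*-comm (suc a) (suc b)) (*-monoˡ-∣ (suc b) a∣p))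

shiftBy : ℕ → Series → Series
shiftBy zero    X = X
shiftBy (suc k) X = shift (shiftBy k X)

shiftBy-cong : ∀ k {a b : Series} → a ≗ b → shiftBy k a ≗ shiftBy k b
shiftBy-cong zero    a≗b = a≗b
shiftBy-cong (suc k) a≗b = shift-cong (shiftBy-cong k a≗b)

shiftBy-< : ∀ k (X : Series) {n} → n < k → shiftBy k X n ≡ + 0
shiftBy-< (suc k) X {zero}  n<k       = refl
shiftBy-< (suc k) X {suc n} (s≤s n<k) = shiftBy-< k X n<k

shiftBy-+ : ∀ k (X : Series) m → shiftBy k X (k + m) ≡ X m
shiftBy-+ zero    X m = refl
shiftBy-+ (suc k) X m = shiftBy-+ k X m

expand-shift : ∀ k (X : Series) → expand (suc k) (shift X) ≗ shiftBy (suc k) (expand (suc k) X)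
expand-shift k X n with n <? suc k
... | yes n<w = trans (below n n<w) (sym (shiftBy-< (suc k) (expand (suc k) X) n<w))
  where
  below : ∀ n → n < suc k → expand (suc k) (shift X) n ≡ + 0
  below zero    _   = refl
  below (suc n) n<w = expand-∤ k (shift X) (λ w∣n → ℕ.<⇒≱ n<w (∣⇒≤ w∣n))
... | no n≮w = subst (λ n → expand (suc k) (shift X) n ≡ shiftBy (suc k) (expand (suc k) X) n)
                     (ℕ.m+[n∸m]≡n (ℕ.≮⇒≥ n≮w)) (above _)
  where
  above : ∀ m → expand (suc k) (shift X) (suc k + m) ≡ shiftBy (suc k) (expand (suc k) X) (suc k + m)
  above m = begin
    expand (suc k) (shift X) (suc k + m)      ≡⟨ cong (expand (suc k) (shift X)) (ℕ.+-comm (suc k) m) ⟩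
    expand (suc k) (shift X) (m + suc k)      ≡⟨ cong (λ w → expand (suc k) (shift X) (m + w)) (sym (ℕ.*-identityˡ (suc k))) ⟩
    expand (suc k) (shift X) (m + 1 * suc k)  ≡⟨ expand-offset k (shift X) 1 m ⟩
    expand (suc k) (λ j → shift X (j + 1)) m  ≡⟨ expand-cong k (λ j → cong (shift X) (ℕ.+-comm j 1)) m ⟩
    expand (suc k) X m                        ≡⟨ sym (shiftBy-+ (suc k) (expand (suc k) X) m) ⟩
    shiftBy (suc k) (expand (suc k) X) (suc k + m) ∎
    where open ≡-Reasoning

stretch : ℕ → List ℤ → List ℤ
stretch k []      = []
stretch k (c ∷ f) = c ∷ (replicate k (+ 0) ++ stretch k f)

mulPoly-zeros++ : ∀ k h (B : Series) → mulPoly (replicate k (+ 0) ++ h) B ≗ shiftBy k (mulPoly h B)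
mulPoly-zeros++ zero    h B n       = refl
mulPoly-zeros++ (suc k) h B zero    = refl
mulPoly-zeros++ (suc k) h B (suc n) = trans (ℤ.+-identityˡ _) (mulPoly-zeros++ k h B n)

expand-mulPoly : ∀ k f (A : Series) →
  expand (suc k) (mulPoly f A) ≗ mulPoly (stretch k f) (expand (suc k) A)
expand-mulPoly k [] A n with n % suc k ≡ᵇ 0
... | true  = refl
... | false = refl
expand-mulPoly k (c ∷ f) A n = begin
  expand (suc k) (mulPoly (c ∷ f) A) n
    ≡⟨ expand-linear k c A (shift (mulPoly f A)) n ⟩
  c *ᶻ A′ n +ᶻ expand (suc k) (shift (mulPoly f A)) n
    ≡⟨ cong (c *ᶻ A′ n +ᶻ_) (expand-shift k (mulPoly f A) n) ⟩
  c *ᶻ A′ n +ᶻ shiftBy (suc k) (expand (suc k) (mulPoly f A)) n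
    ≡⟨ cong (c *ᶻ A′ n +ᶻ_) (shiftBy-cong (suc k) (expand-mulPoly k f A) n) ⟩
  c *ᶻ A′ n +ᶻ shift (shiftBy k (mulPoly (stretch k f) A′)) n
    ≡⟨ cong (c *ᶻ A′ n +ᶻ_) (shift-cong (λ m → sym (mulPoly-zeros++ k (stretch k f) A′ m)) n) ⟩
  mulPoly (stretch k (c ∷ f)) A′ n ∎
  where
  open ≡-Reasoning
  A′ = expand (suc k) A

infixl 6 _⊕_
infixl 7 _⊛_

_⊕_ : List ℤ → List ℤ → List ℤ
[]      ⊕ g       = g
(a ∷ f) ⊕ []      = a ∷ f
(a ∷ f) ⊕ (b ∷ g) = (a +ᶻ b) ∷ (f ⊕ g)

_⊛_ : List ℤ → List ℤ → List ℤ
[]      ⊛ f = []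
(c ∷ g) ⊛ f = map (c *ᶻ_) f ⊕ (+ 0 ∷ g ⊛ f)

mulPoly-⊕ : ∀ f g (B : Series) → mulPoly (f ⊕ g) B ≗ mulPoly f B +ˢ mulPoly g B
mulPoly-⊕ []      g       B n = sym (ℤ.+-identityˡ _)
mulPoly-⊕ (a ∷ f) []      B n = sym (ℤ.+-identityʳ _)
mulPoly-⊕ (a ∷ f) (b ∷ g) B n = begin
  (a +ᶻ b) *ᶻ B n +ᶻ shift (mulPoly (f ⊕ g) B) n
    ≡⟨ cong ((a +ᶻ b) *ᶻ B n +ᶻ_) (shift-cong (mulPoly-⊕ f g B) n) ⟩
  (a +ᶻ b) *ᶻ B n +ᶻ shift (mulPoly f B +ˢ mulPoly g B) n
    ≡⟨ cong ((a +ᶻ b) *ᶻ B n +ᶻ_) (shift-+ˢ (mulPoly f B) (mulPoly g B) n) ⟩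
  (a +ᶻ b) *ᶻ B n +ᶻ (shift (mulPoly f B) n +ᶻ shift (mulPoly g B) n)
    ≡⟨ distrib a b (B n) _ _ ⟩
  (a *ᶻ B n +ᶻ shift (mulPoly f B) n) +ᶻ (b *ᶻ B n +ᶻ shift (mulPoly g B) n) ∎
  where
  open ≡-Reasoning
  distrib : ∀ a b x u v → (a +ᶻ b) *ᶻ x +ᶻ (u +ᶻ v) ≡ (a *ᶻ x +ᶻ u) +ᶻ (b *ᶻ x +ᶻ v)
  distrib = solve-∀

mulPoly-scale : ∀ c f (B : Series) n → mulPoly (map (c *ᶻ_) f) B n ≡ c *ᶻ mulPoly f B n
mulPoly-scale c []      B n = sym (ℤ.*-zeroʳ c)
mulPoly-scale c (a ∷ f) B n =
  trans (cong (c *ᶻ a *ᶻ B n +ᶻ_) (shift-scale n)) (distrib c a (B n) _)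
  where
  shift-scale : ∀ n → shift (mulPoly (map (c *ᶻ_) f) B) n ≡ c *ᶻ shift (mulPoly f B) n
  shift-scale zero    = sym (ℤ.*-zeroʳ c)
  shift-scale (suc n) = mulPoly-scale c f B n
  distrib : ∀ c a x y → c *ᶻ a *ᶻ x +ᶻ c *ᶻ y ≡ c *ᶻ (a *ᶻ x +ᶻ y)
  distrib = solve-∀

mulPoly-⊛ : ∀ g f (B : Series) → mulPoly g (mulPoly f B) ≗ mulPoly (g ⊛ f) B
mulPoly-⊛ []      f B n = refl
mulPoly-⊛ (c ∷ g) f B n = sym (begin
  mulPoly (map (c *ᶻ_) f ⊕ (+ 0 ∷ g ⊛ f)) B n
    ≡⟨ mulPoly-⊕ (map (c *ᶻ_) f) (+ 0 ∷ g ⊛ f) B n ⟩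
  mulPoly (map (c *ᶻ_) f) B n +ᶻ (+ 0 +ᶻ shift (mulPoly (g ⊛ f) B) n)
    ≡⟨ cong₂ _+ᶻ_ (mulPoly-scale c f B n) (ℤ.+-identityˡ _) ⟩
  c *ᶻ mulPoly f B n +ᶻ shift (mulPoly (g ⊛ f) B) n
    ≡⟨ cong (c *ᶻ mulPoly f B n +ᶻ_) (shift-cong (λ m → sym (mulPoly-⊛ g f B m)) n) ⟩
  mulPoly (c ∷ g) (mulPoly f B) n ∎)
  where open ≡-Reasoning

≤P-trans : ∀ {S T U} → S ≤P T → T ≤P U → S ≤P U
≤P-trans (f , zero , () , _)
≤P-trans (f , suc a , _ , _) (g , zero , () , _)
≤P-trans {S} {T} {U} (f , suc a , _ , f∶S→T) (g , suc b , _ , g∶T→U) =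
  g ⊛ stretch b f , suc b * suc a , s≤s z≤n , λ n → begin
    mulPoly (g ⊛ stretch b f) (expand (suc b * suc a) (H S)) n
      ≡⟨ mulPoly-cong (g ⊛ stretch b f) (λ m → sym (expand-expand a b (H S) m)) n ⟩
    mulPoly (g ⊛ stretch b f) (expand (suc b) (expand (suc a) (H S))) n
      ≡⟨ sym (mulPoly-⊛ g (stretch b f) _ n) ⟩
    mulPoly g (mulPoly (stretch b f) (expand (suc b) (expand (suc a) (H S)))) n
      ≡⟨ mulPoly-cong g (λ m → sym (expand-mulPoly b f _ m)) n ⟩
    mulPoly g (expand (suc b) (mulPoly f (expand (suc a) (H S)))) n
      ≡⟨ mulPoly-cong g (expand-cong b f∶S→T) n ⟩
    mulPoly g (expand (suc b) (H T)) n
      ≡⟨ g∶T→U n ⟩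
    H U n ∎
  where open ≡-Reasoning

H-∈ : ∀ S {n} → mem S n ≡ true → H S n ≡ + 1
H-∈ S {n} n∈S rewrite n∈S = refl

H-∉ : ∀ S {n} → mem S n ≡ false → H S n ≡ + 0
H-∉ S {n} n∉S rewrite n∉S = refl

H-cong : ∀ S T {n} → mem S n ≡ mem T n → H S n ≡ H T n
H-cong S T {n} eq rewrite eq = refl

H-injective : ∀ S T {n} → H S n ≡ H T n → mem S n ≡ mem T n
H-injective S T {n} eq with mem S n | mem T n
... | true  | true  = refl
... | false | false = refl
... | true  | false = case eq of λ ()
... | false | true  = case eq of λ ()

IsFrobenius : NumericalSemigroup → ℕ → Set
IsFrobenius S F = mem S F ≡ false × (∀ m → F < m → mem S m ≡ true)

frobenius : ∀ S {g} → mem S g ≡ false → ∃ (IsFrobenius S)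
frobenius S {g} g∉S with cofinite S
... | N , above-N = search N above-N
  where
  search : ∀ N → (∀ n → N ≤ n → mem S n ≡ true) → ∃ (IsFrobenius S)
  search zero    above-N = case trans (sym (above-N g z≤n)) g∉S of λ ()
  search (suc N) above-N with mem S N in N∈?S
  ... | false = N , N∈?S , above-N
  ... | true  = search N above-N′
    where
    above-N′ : ∀ n → N ≤ n → mem S n ≡ true
    above-N′ n N≤n with ℕ.m≤n⇒m<n∨m≡n N≤n
    ... | inj₁ N<n  = above-N n N<n
    ... | inj₂ refl = N∈?S

gap≤frobenius : ∀ S {F g} → IsFrobenius S F → mem S g ≡ false → g ≤ F
gap≤frobenius S (_ , above-F) g∉S = ℕ.≮⇒≥ (λ F<g → case trans (sym (above-F _ F<g)) g∉S of λ ())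

frobenius-positive : ∀ S {F} → IsFrobenius S F → 0 < F
frobenius-positive S {zero}  (0∉S , _) = case trans (sym (zero∈ S)) 0∉S of λ ()
frobenius-positive S {suc F} _         = s≤s z≤n

Relates : List ℤ → ℕ → NumericalSemigroup → NumericalSemigroup → Set
Relates f w S T = mulPoly f (expand w (H S)) ≗ H T

IsDegree : List ℤ → ℕ → Set
IsDegree f d = coef f d ≢ + 0 × (∀ j → d < j → coef f j ≡ + 0)

vanishing⊎degree : ∀ f → (∀ j → coef f j ≡ + 0) ⊎ ∃ (IsDegree f)
vanishing⊎degree []      = inj₁ (λ j → refl)
vanishing⊎degree (c ∷ f) with vanishing⊎degree f
... | inj₂ (d , c_d≢0 , high≡0) =
  inj₂ (suc d , c_d≢0 , λ { zero () ; (suc j) (s≤s d<j) → high≡0 j d<j })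
... | inj₁ f≡0 with c ℤ.≟ + 0
...   | yes c≡0 = inj₁ (λ { zero → c≡0 ; (suc j) → f≡0 j })
...   | no  c≢0 = inj₂ (0 , c≢0 , λ { zero () ; (suc j) _ → f≡0 j })

relating-degree : ∀ f {w} S T → Relates f w S T → ∃ (IsDegree f)
relating-degree f S T rel with vanishing⊎degree f
... | inj₂ degree = degree
... | inj₁ f≡0    =
  case trans (sym (H-∈ T (zero∈ T))) (trans (sym (rel 0)) (mulPoly-vanishing f _ f≡0 0)) of λ ()

-- Shifting H_S(x^w) by (F + M)·w instead of F·w only restores its missing term x^(F·w)
-- (lemma jump), so the coefficients of H_T at d + F·w and at d + (F + M)·w, the latter
-- deep inside T, differ exactly by the leading coefficient of f.
frobenius-gap : ∀ S T f k {F d} → Relates f (suc k) S T → IsFrobenius S F → IsDegree f d →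
  mem T (d + F * suc k) ≡ false
frobenius-gap S T f k {F} {d} rel (F∉S , above-F) (c_d≢0 , high≡0)
  with mem T (d + F * suc k) in n∈?T
... | false = refl
... | true  = ⊥-elim (c_d≢0 (∙-cancelˡ (+ 1) (coef f d) (+ 0) (sym leading)))
  where
  open ≡-Reasoning
  w = suc k
  a = expand w (H S)
  N = proj₁ (cofinite T)
  M = suc N

  jump : (λ i → a (i + (F + M) * w)) ≗ (λ i → a (i + F * w)) +ˢ δ₀
  jump zero = begin
    a ((F + M) * w)         ≡⟨ expand-∣ k (H S) (F + M) ⟩
    H S (F + M)             ≡⟨ H-∈ S (above-F (F + M) (ℕ.m<m+n F (s≤s z≤n))) ⟩
    + 1                     ≡⟨ cong (_+ᶻ + 1) (sym (trans (expand-∣ k (H S) F) (H-∉ S F∉S))) ⟩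
    a (F * w) +ᶻ + 1        ∎
  jump (suc i) = begin
    a (suc i + (F + M) * w)                      ≡⟨ expand-offset k (H S) (F + M) (suc i) ⟩
    expand w (λ j → H S (j + (F + M))) (suc i)   ≡⟨ expand-cong-suc k {λ j → H S (j + (F + M))} {λ j → H S (j + F)} in-S i ⟩
    expand w (λ j → H S (j + F)) (suc i)         ≡⟨ sym (expand-offset k (H S) F (suc i)) ⟩
    a (suc i + F * w)                            ≡⟨ sym (ℤ.+-identityʳ _) ⟩
    a (suc i + F * w) +ᶻ + 0                     ∎
    where
    in-S : ∀ j → H S (suc j + (F + M)) ≡ H S (suc j + F)
    in-S j = trans (H-∈ S (above-F _ (s≤s (ℕ.≤-trans (ℕ.m≤m+n F M) (ℕ.m≤n+m (F + M) j)))))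
                   (sym (H-∈ S (above-F _ (s≤s (ℕ.m≤n+m F j)))))

  deep-in-T : N ≤ d + (F + M) * w
  deep-in-T = ℕ.≤-trans (ℕ.n≤1+n N)
    (ℕ.≤-trans (ℕ.m≤n+m M F) (ℕ.≤-trans (ℕ.m≤m*n (F + M) w) (ℕ.m≤n+m _ d)))

  leading : + 1 ≡ + 1 +ᶻ coef f d
  leading = begin
    + 1                                                  ≡⟨ sym (H-∈ T (proj₂ (cofinite T) _ deep-in-T)) ⟩
    H T (d + (F + M) * w)                                ≡⟨ sym (rel _) ⟩
    mulPoly f a (d + (F + M) * w)                        ≡⟨ mulPoly-window f a d high≡0 _ ⟩
    mulPoly f (λ i → a (i + (F + M) * w)) d              ≡⟨ mulPoly-cong f jump d ⟩
    mulPoly f ((λ i → a (i + F * w)) +ˢ δ₀) d            ≡⟨ mulPoly-+ˢ f _ δ₀ d ⟩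
    mulPoly f (λ i → a (i + F * w)) d +ᶻ mulPoly f δ₀ d  ≡⟨ cong₂ _+ᶻ_ (sym (mulPoly-window f a d high≡0 _)) (mulPoly-δ₀ f d) ⟩
    mulPoly f a (d + F * w) +ᶻ coef f d                  ≡⟨ cong (_+ᶻ coef f d) (trans (rel _) (H-∈ T n∈?T)) ⟩
    + 1 +ᶻ coef f d                                      ∎

constant-relation⇒≈S : ∀ S T f → Relates f 1 S T → (∀ j → 0 < j → coef f j ≡ + 0) → S ≈S T
constant-relation⇒≈S S T f rel high≡0 n = H-injective S T (begin
  H S n                         ≡⟨ sym (ℤ.*-identityˡ _) ⟩
  + 1 *ᶻ H S n                  ≡⟨ cong (_*ᶻ H S n) (sym c₀≡1) ⟩
  coef f 0 *ᶻ H S n             ≡⟨ sym (scaled n) ⟩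
  mulPoly f (expand 1 (H S)) n  ≡⟨ rel n ⟩
  H T n                         ∎)
  where
  open ≡-Reasoning
  scaled : ∀ n → mulPoly f (expand 1 (H S)) n ≡ coef f 0 *ᶻ H S n
  scaled n = trans (mulPoly-constant f _ high≡0 n) (cong (coef f 0 *ᶻ_) (expand-1 (H S) n))
  c₀≡1 : coef f 0 ≡ + 1
  c₀≡1 = begin
    coef f 0                      ≡⟨ sym (ℤ.*-identityʳ _) ⟩
    coef f 0 *ᶻ + 1               ≡⟨ cong (coef f 0 *ᶻ_) (sym (H-∈ S (zero∈ S))) ⟩
    coef f 0 *ᶻ H S 0             ≡⟨ sym (scaled 0) ⟩
    mulPoly f (expand 1 (H S)) 0  ≡⟨ rel 0 ⟩
    H T 0                         ≡⟨ H-∈ T (zero∈ T) ⟩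
    + 1                           ∎

frobenius-bound : ∀ F d k → 0 < F → d + F * suc k ≤ F → d ≡ 0 × k ≡ 0
frobenius-bound F d k F>0 bound = ℕ.m+n≡0⇒m≡0 d excess≡0 , k≡0 F>0 (ℕ.m+n≡0⇒n≡0 d excess≡0)
  where
  rearrange : ∀ F d k → d + F * suc k ≡ F + (d + F * k)
  rearrange = NatSolver.solve-∀
  excess≡0 : d + F * k ≡ 0
  excess≡0 = ℕ.n≤0⇒n≡0 (ℕ.+-cancelˡ-≤ F _ _
    (subst₂ _≤_ (rearrange F d k) (sym (ℕ.+-identityʳ F)) bound))
  k≡0 : ∀ {F} → 0 < F → F * k ≡ 0 → k ≡ 0
  k≡0 {suc F} _ Fk≡0 = ℕ.*-cancelˡ-≡ k 0 (suc F) (trans Fk≡0 (sym (ℕ.*-zeroʳ (suc F))))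

≤P-antisym-at-gap : ∀ {S T} → S ≤P T → T ≤P S → ∀ {g} → mem S g ≡ false → S ≈S T
≤P-antisym-at-gap (f , zero , () , _)
≤P-antisym-at-gap (f , suc k , _ , _) (g , zero , () , _)
≤P-antisym-at-gap {S} {T} (f , suc k , _ , f∶S→T) (g , suc v , _ , g∶T→S) g∉S
  with frobenius S g∉S | relating-degree f S T f∶S→T
... | F , frobS | d , deg-f@(_ , high≡0)
  with frobenius T (frobenius-gap S T f k f∶S→T frobS deg-f) | relating-degree g T S g∶T→S
... | G , frobT | e , deg-g
  with frobenius-bound F d k (frobenius-positive S frobS) bound
  where
  open ℕ.≤-Reasoning
  bound : d + F * suc k ≤ F
  bound = begin
    d + F * suc k  ≤⟨ gap≤frobenius T frobT (frobenius-gap S T f k f∶S→T frobS deg-f) ⟩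
    G              ≤⟨ ℕ.m≤m*n G (suc v) ⟩
    G * suc v      ≤⟨ ℕ.m≤n+m _ e ⟩
    e + G * suc v  ≤⟨ gap≤frobenius S frobS (frobenius-gap T S g v g∶T→S frobT deg-g) ⟩
    F              ∎
... | refl , refl = constant-relation⇒≈S S T f f∶S→T high≡0

≤P-antisym : ∀ {S T} → S ≤P T → T ≤P S → S ≈S T
≤P-antisym {S} {T} S≤T T≤S n with mem S n in n∈?S | mem T n in n∈?T
... | false | _     = trans (sym n∈?S) (trans (≤P-antisym-at-gap {S} {T} S≤T T≤S n∈?S n) n∈?T)
... | _     | false = trans (sym n∈?S) (trans (sym (≤P-antisym-at-gap {T} {S} T≤S S≤T n∈?T n)) n∈?T)
... | true  | true  = refl

≤P-reflexive : ∀ {S T} → S ≈S T → S ≤P T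
≤P-reflexive {S} {T} S≈T = + 1 ∷ [] , 1 , s≤s z≤n , λ n → begin
  mulPoly (+ 1 ∷ []) (expand 1 (H S)) n  ≡⟨ mulPoly-constant (+ 1 ∷ []) (expand 1 (H S)) (λ { (suc j) _ → refl }) n ⟩
  + 1 *ᶻ expand 1 (H S) n                ≡⟨ ℤ.*-identityˡ _ ⟩
  expand 1 (H S) n                       ≡⟨ expand-1 (H S) n ⟩
  H S n                                  ≡⟨ H-cong S T (S≈T n) ⟩
  H T n                                  ∎
  where open ≡-Reasoning

mainTheorem16 : IsPartialOrder _≈S_ _≤P_
mainTheorem16 = record
  { isPreorder = record
    { isEquivalence = record
      { refl  = λ {S} _ → refl
      ; sym   = λ {S} {T} S≈T n → sym (S≈T n)
      ; trans = λ {S} {T} {U} S≈T T≈U n → trans (S≈T n) (T≈U n)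
      }
    ; reflexive = λ {S} {T} → ≤P-reflexive {S} {T}
    ; trans     = λ {S} {T} {U} → ≤P-trans {S} {T} {U}
    }
  ; antisym = λ {S} {T} → ≤P-antisym {S} {T}
  }
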